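{- Let $\mathcal{MC}$ be the family of all $\exists$-saturated maximal $\mathsf{FOL\Box}$-consistent sets and $R=\{\langle\Gamma,\Delta\rangle\in\mathcal{MC}\times\mathcal{MC}: \text{for every formula } A,\ \Box A\in\Gamma\Rightarrow A\in\Delta\}$. Then $R$ is the universal relation on $\mathcal{MC}$, i.e. $R=\mathcal{MC}\times\mathcal{MC}$.
   Context: Language $\mathcal{L}(\forall,\Box)$: first-order language with identity $=$, predicate symbols, variables, no constants or function symbols, connectives $\neg,\to$, quantifier $\forall$, modal operator $\Box$ (arbitrary nesting); $\Diamond:=\neg\Box\neg$. A formula is $\Box$-free if it contains no $\Box$. $\mathsf{FOL}$ is the set of $\Box$-free theses of classical first-order logic with identity. An occurrence of $x$ in $A$ is $\forall\Box$-bound if it is in the scope of a quantifier on $x$ or inside the scope of some $\Box$; otherwise $\forall\Box$-free. $x$ is a $\forall\Box$-free variable of $A$ if it has a $\forall\Box$-free occurrence. $A(^y/_x)$ is the simultaneous replacement of every $\forall\Box$-free occurrence of $x$ by $y$, provided $y$ is not captured by a quantifier. $\mathsf{FOL\Box}$ is the smallest set of formulas containing all instances of propositional tautologies and all instances of: $\Box(A\to B)\to(\Box A\to\Box B)$; $\Box A\to A$; $\neg\Box A\to\Box\neg\Box A$; $\forall xA\to A(^y/_x)$ (admissible $\forall\Box$-free substitution); $\forall x(A\to B)\to(A\to\forall xB)$ if $x$ is not $\forall\Box$-free in $A$; $x=x$; $x=y\wedge A(x)\to A(y)$ for $\Box$-free $A$ (usual first-order identity axiom); $\Box A\to\forall xA$;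 $\neg\Box A$ for every $\Box$-free $A\notin\mathsf{FOL}$; closed under: $A\in\mathsf{FOL\Box}\Rightarrow\Box A\in\mathsf{FOL\Box}$, and modus ponens. A set $\Gamma$ is $\mathsf{FOL\Box}$-consistent if there is no finite $\{B_1,\dots,B_k\}\subseteq\Gamma$ with $\neg(B_1\wedge\dots\wedge B_k)\in\mathsf{FOL\Box}$; maximal consistent if consistent and no proper superset is consistent. $\Gamma$ is $\exists$-saturated if for every $\neg\forall xA\in\Gamma$ there is a variable $y$ with $A(^y/_x)$ admissible and $\neg A(^y/_x)\in\Gamma$. -}

module Defs where

open import Data.Nat using (ℕ; _≟_)
open import Data.Bool using (Bool; true; false; not; _∨_; if_then_else_)
open import Data.List using (List; []; _∷_; map)
open import Data.List.Membership.Propositional using (_∈_)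
open import Data.List.Relation.Unary.All using (All)
open import Data.Product using (_×_; Σ; ∃)
open import Data.Sum using (_⊎_)
open import Data.Unit using (⊤)
open import Data.Empty using (⊥)
open import Relation.Nullary using (¬_; yes; no)
open import Relation.Binary.PropositionalEquality using (_≡_; _≢_)

-- Variables are natural numbers; predicate symbols are natural numbers
-- (applied to a list of variables; the list length is the arity).
Var : Set
Var = ℕ

data Formula : Set where
  _≐_  : Var → Var → Formula
  pred : ℕ → List Var → Formula
  ¬'_  : Formula → Formula
  _⇒_  : Formula → Formula → Formula
  ∀'   : Var → Formula → Formula
  □    : Formula → Formula

infixr 5 _⇒_

_∧'_ : Formula → Formula → Formula
A ∧' B = ¬' (A ⇒ ¬' B)

◇ : Formula → Formula
◇ A = ¬' □ (¬' A)

BoxFree : Formula → Set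
BoxFree (x ≐ y)    = ⊤
BoxFree (pred _ _) = ⊤
BoxFree (¬' A)     = BoxFree A
BoxFree (A ⇒ B)    = BoxFree A × BoxFree B
BoxFree (∀' _ A)   = BoxFree A
BoxFree (□ _)      = ⊥

FreeIn : Var → Formula → Set
FreeIn x (a ≐ b)     = (a ≡ x) ⊎ (b ≡ x)
FreeIn x (pred _ as) = x ∈ as
FreeIn x (¬' A)      = FreeIn x A
FreeIn x (A ⇒ B)     = FreeIn x A ⊎ FreeIn x B
FreeIn x (∀' z A)    = (z ≢ x) × FreeIn x A
FreeIn x (□ _)       = ⊥

rn : Var → Var → Var → Var
rn y x a with a ≟ x
... | yes _ = y
... | no  _ = a

sub : Var → Var → Formula → Formula
sub y x (a ≐ b)     = rn y x a ≐ rn y x b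
sub y x (pred p as) = pred p (map (rn y x) as)
sub y x (¬' A)      = ¬' sub y x A
sub y x (A ⇒ B)     = sub y x A ⇒ sub y x B
sub y x (∀' z A) with z ≟ x
... | yes _ = ∀' z A
... | no  _ = ∀' z (sub y x A)
sub y x (□ A)       = □ A

-- A(y/x) is admissible: no replaced occurrence of x gets captured by a ∀y
Admissible : Var → Var → Formula → Set
Admissible y x (a ≐ b)    = ⊤
Admissible y x (pred _ _) = ⊤
Admissible y x (¬' A)     = Admissible y x A
Admissible y x (A ⇒ B)    = Admissible y x A × Admissible y x B
Admissible y x (∀' z A) with z ≟ x
... | yes _ = ⊤
... | no  _ = Admissible y x A × (z ≡ y → ¬ FreeIn x A)
Admissible y x (□ _)      = ⊤

-- instances of propositional tautologies: formulas true under every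
-- Boolean valuation of their maximal non-(¬,→) subformulas
eval : (Formula → Bool) → Formula → Bool
eval v (¬' A)  = not (eval v A)
eval v (A ⇒ B) = not (eval v A) ∨ eval v B
eval v A       = v A

Taut : Formula → Set
Taut A = (v : Formula → Bool) → eval v A ≡ true

data FOLDer : Formula → Set where
  taut   : ∀ {A} → BoxFree A → Taut A → FOLDer A
  inst   : ∀ {x y A} → BoxFree A → Admissible y x A → FOLDer (∀' x A ⇒ sub y x A)
  dist   : ∀ {x A B} → BoxFree A → BoxFree B → ¬ FreeIn x A →
           FOLDer (∀' x (A ⇒ B) ⇒ (A ⇒ ∀' x B))
  refl≐  : ∀ {x} → FOLDer (x ≐ x)
  ident  : ∀ {x y A} → BoxFree A → Admissible y x A →
           FOLDer (((x ≐ y) ∧' A) ⇒ sub y x A)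
  gen    : ∀ {x A} → FOLDer A → FOLDer (∀' x A)
  mp     : ∀ {A B} → FOLDer (A ⇒ B) → FOLDer A → FOLDer B

FOL : Formula → Set
FOL A = BoxFree A × FOLDer A

data FOL□ : Formula → Set where
  taut   : ∀ {A} → Taut A → FOL□ A
  K      : ∀ {A B} → FOL□ (□ (A ⇒ B) ⇒ (□ A ⇒ □ B))
  T      : ∀ {A} → FOL□ (□ A ⇒ A)
  five   : ∀ {A} → FOL□ (¬' □ A ⇒ □ (¬' □ A))
  inst   : ∀ {x y A} → Admissible y x A → FOL□ (∀' x A ⇒ sub y x A)
  dist   : ∀ {x A B} → ¬ FreeIn x A → FOL□ (∀' x (A ⇒ B) ⇒ (A ⇒ ∀' x B))
  refl≐  : ∀ {x} → FOL□ (x ≐ x)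
  ident  : ∀ {x y A} → BoxFree A → Admissible y x A →
           FOL□ (((x ≐ y) ∧' A) ⇒ sub y x A)
  □∀     : ∀ {x A} → FOL□ (□ A ⇒ ∀' x A)
  non□   : ∀ {A} → BoxFree A → ¬ FOL A → FOL□ (¬' □ A)
  nec    : ∀ {A} → FOL□ A → FOL□ (□ A)
  mp     : ∀ {A B} → FOL□ (A ⇒ B) → FOL□ A → FOL□ B

FSet : Set₁
FSet = Formula → Set

_⊆_ : FSet → FSet → Set
Γ ⊆ Δ = ∀ {A} → Γ A → Δ A

conj : Formula → List Formula → Formula
conj B []       = B
conj B (C ∷ Cs) = B ∧' conj C Cs

Consistent : FSet → Set
Consistent Γ = (B : Formula) (Bs : List Formula) → Γ B → All Γ Bs →
               ¬ FOL□ (¬' conj B Bs)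

MaxConsistent : FSet → Set₁
MaxConsistent Γ = Consistent Γ × ((Γ' : FSet) → Γ ⊆ Γ' → Consistent Γ' → Γ' ⊆ Γ)

∃-Saturated : FSet → Set
∃-Saturated Γ = ∀ x A → Γ (¬' ∀' x A) →
                Σ Var (λ y → Admissible y x A × Γ (¬' sub y x A))

MC : FSet → Set₁
MC Γ = ∃-Saturated Γ × MaxConsistent Γ

R : FSet → FSet → Set₁
R Γ Δ = MC Γ × MC Δ × (∀ A → Γ (□ A) → Δ A)

-- Every formula is FOL□-equivalent to a □-free one: working inside out,
-- a subformula □C, with C already □-free, is either a theorem (when C ∈ FOL,
-- by necessitation) or refutable (by the axiom ¬□C for C ∉ FOL), so it can
-- be replaced by x ≐ x or its negation. Hence every □A is decided by FOL□.
-- If □A lies in a consistent Γ it cannot be refutable, so ⊢ A; and a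
-- theorem belongs to every maximal consistent Δ, since adding it could only
-- be inconsistent if FOL□ were, which the nonempty consistent Γ rules out. The case split is
-- classical.
module Submission where

open import Defs
open import Data.Bool using (true; false)
open import Data.List using (List; []; _∷_)
open import Data.List.Properties using (map-cong; map-id)
open import Data.List.Relation.Unary.All using (All; []; _∷_)
open import Data.Nat using (_≟_)
open import Data.Product using (Σ; _×_; _,_; proj₁; swap)
open import Data.Sum using (_⊎_; inj₁; inj₂; [_,_])
open import Data.Unit using (tt)
open import Effect.Monad using (RawMonad)
open import Level using (0ℓ)
open import Relation.Nullary using (¬_; Dec; yes; no)
open import Relation.Nullary.Decidable using (¬¬-excluded-middle)
open import Relation.Nullary.Negation
  using (DoubleNegation; Stable; ¬¬-Monad; contradiction)
open import Relation.Binary.PropositionalEquality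
  using (_≡_; refl; trans; cong; cong₂; subst)

open RawMonad (¬¬-Monad {0ℓ})

infixl 6 _·_
_·_ : ∀ {A B} → FOL□ (A ⇒ B) → FOL□ A → FOL□ B
_·_ = FOL□.mp

⇒-refl : ∀ A → FOL□ (A ⇒ A)
⇒-refl A = FOL□.taut table
  where
  table : Taut (A ⇒ A)
  table v with eval v A
  ... | true  = refl
  ... | false = refl

⇒-const : ∀ {A B} → FOL□ B → FOL□ (A ⇒ B)
⇒-const {A} {B} ⊢B = FOL□.taut table · ⊢B
  where
  table : Taut (B ⇒ A ⇒ B)
  table v with eval v B | eval v A
  ... | true  | true  = refl
  ... | true  | false = refl
  ... | false | true  = refl
  ... | false | false = refl

⇒-trans : ∀ {A B C} → FOL□ (A ⇒ B) → FOL□ (B ⇒ C) → FOL□ (A ⇒ C)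
⇒-trans {A} {B} {C} ⊢A⇒B ⊢B⇒C = FOL□.taut table · ⊢A⇒B · ⊢B⇒C
  where
  table : Taut ((A ⇒ B) ⇒ (B ⇒ C) ⇒ (A ⇒ C))
  table v with eval v A | eval v B | eval v C
  ... | true  | true  | true  = refl
  ... | true  | true  | false = refl
  ... | true  | false | true  = refl
  ... | true  | false | false = refl
  ... | false | true  | true  = refl
  ... | false | true  | false = refl
  ... | false | false | true  = refl
  ... | false | false | false = refl

contrapose : ∀ {A B} → FOL□ (A ⇒ B) → FOL□ (¬' B ⇒ ¬' A)
contrapose {A} {B} ⊢A⇒B = FOL□.taut table · ⊢A⇒B
  where
  table : Taut ((A ⇒ B) ⇒ (¬' B ⇒ ¬' A))
  table v with eval v A | eval v B
  ... | true  | true  = refl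
  ... | true  | false = refl
  ... | false | true  = refl
  ... | false | false = refl

⇒-mono : ∀ {A A′ B B′} → FOL□ (A′ ⇒ A) → FOL□ (B ⇒ B′) → FOL□ ((A ⇒ B) ⇒ (A′ ⇒ B′))
⇒-mono {A} {A′} {B} {B′} ⊢A′⇒A ⊢B⇒B′ = FOL□.taut table · ⊢A′⇒A · ⊢B⇒B′
  where
  table : Taut ((A′ ⇒ A) ⇒ (B ⇒ B′) ⇒ ((A ⇒ B) ⇒ (A′ ⇒ B′)))
  table v with eval v A | eval v A′ | eval v B | eval v B′
  ... | true  | true  | true  | true  = refl
  ... | true  | true  | true  | false = refl
  ... | true  | true  | false | true  = refl
  ... | true  | true  | false | false = refl
  ... | true  | false | true  | true  = refl
  ... | true  | false | true  | false = refl
  ... | true  | false | false | true  = refl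
  ... | true  | false | false | false = refl
  ... | false | true  | true  | true  = refl
  ... | false | true  | true  | false = refl
  ... | false | true  | false | true  = refl
  ... | false | true  | false | false = refl
  ... | false | false | true  | true  = refl
  ... | false | false | true  | false = refl
  ... | false | false | false | true  = refl
  ... | false | false | false | false = refl

⇒-from-refuted : ∀ {A B} → FOL□ (¬' A) → FOL□ (A ⇒ B)
⇒-from-refuted {A} {B} ⊢¬A = FOL□.taut table · ⊢¬A
  where
  table : Taut (¬' A ⇒ A ⇒ B)
  table v with eval v A | eval v B
  ... | true  | true  = refl
  ... | true  | false = refl
  ... | false | true  = refl
  ... | false | false = refl

∧-intro : ∀ {P A B} → FOL□ (P ⇒ A) → FOL□ (P ⇒ B) → FOL□ (P ⇒ A ∧' B)
∧-intro {P} {A} {B} ⊢P⇒A ⊢P⇒B = FOL□.taut table · ⊢P⇒A · ⊢P⇒B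
  where
  table : Taut ((P ⇒ A) ⇒ (P ⇒ B) ⇒ (P ⇒ A ∧' B))
  table v with eval v P | eval v A | eval v B
  ... | true  | true  | true  = refl
  ... | true  | true  | false = refl
  ... | true  | false | true  = refl
  ... | true  | false | false = refl
  ... | false | true  | true  = refl
  ... | false | true  | false = refl
  ... | false | false | true  = refl
  ... | false | false | false = refl

∧-monoʳ : ∀ {A B B′} → FOL□ (B ⇒ B′) → FOL□ (A ∧' B ⇒ A ∧' B′)
∧-monoʳ {A} {B} {B′} ⊢B⇒B′ = FOL□.taut table · ⊢B⇒B′
  where
  table : Taut ((B ⇒ B′) ⇒ (A ∧' B ⇒ A ∧' B′))
  table v with eval v A | eval v B | eval v B′
  ... | true  | true  | true  = refl
  ... | true  | true  | false = refl
  ... | true  | false | true  = refl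
  ... | true  | false | false = refl
  ... | false | true  | true  = refl
  ... | false | true  | false = refl
  ... | false | false | true  = refl
  ... | false | false | false = refl

¬⇒-from-proved : ∀ {A B} → FOL□ A → FOL□ (¬' A ⇒ B)
¬⇒-from-proved {A} {B} ⊢A = FOL□.taut table · ⊢A
  where
  table : Taut (A ⇒ ¬' A ⇒ B)
  table v with eval v A | eval v B
  ... | true  | true  = refl
  ... | true  | false = refl
  ... | false | true  = refl
  ... | false | false = refl

explode : ∀ {A B} → FOL□ A → FOL□ (¬' A) → FOL□ B
explode ⊢A ⊢¬A = ¬⇒-from-proved ⊢A · ⊢¬A

rn-self : ∀ x a → rn x x a ≡ a
rn-self x a with a ≟ x
... | yes refl = refl
... | no  _    = refl

sub-self : ∀ x A → sub x x A ≡ A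
sub-self x (a ≐ b)     = cong₂ _≐_ (rn-self x a) (rn-self x b)
sub-self x (pred p as) = cong (pred p) (trans (map-cong (rn-self x) as) (map-id as))
sub-self x (¬' A)      = cong ¬'_ (sub-self x A)
sub-self x (A ⇒ B)     = cong₂ _⇒_ (sub-self x A) (sub-self x B)
sub-self x (∀' z A) with z ≟ x
... | yes _ = refl
... | no  _ = cong (∀' z) (sub-self x A)
sub-self x (□ A)       = refl

admissible-self : ∀ x A → Admissible x x A
admissible-self x (a ≐ b)    = tt
admissible-self x (pred _ _) = tt
admissible-self x (¬' A)     = admissible-self x A
admissible-self x (A ⇒ B)    = admissible-self x A , admissible-self x B
admissible-self x (∀' z A) with z ≟ x
... | yes _   = tt
... | no  z≢x = admissible-self x A , λ z≡x → contradiction z≡x z≢x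
admissible-self x (□ A)      = tt

∀-elim : ∀ {x A} → FOL□ (∀' x A ⇒ A)
∀-elim {x} {A} =
  subst (λ B → FOL□ (∀' x A ⇒ B)) (sub-self x A) (FOL□.inst (admissible-self x A))

-- FOL□ has no generalisation rule; it comes from necessitation and □A → ∀xA.
generalise : ∀ {x A} → FOL□ A → FOL□ (∀' x A)
generalise ⊢A = FOL□.□∀ · FOL□.nec ⊢A

∀-mono : ∀ {x A B} → FOL□ (A ⇒ B) → FOL□ (∀' x A ⇒ ∀' x B)
∀-mono {x} {A} ⊢A⇒B =
  FOL□.dist {x} {∀' x A} (λ x-free → proj₁ x-free refl) · generalise (⇒-trans ∀-elim ⊢A⇒B)

□-mono : ∀ {A B} → FOL□ (A ⇒ B) → FOL□ (□ A ⇒ □ B)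
□-mono ⊢A⇒B = FOL□.K · FOL□.nec ⊢A⇒B

FOL⊆FOL□ : ∀ {A} → FOLDer A → FOL□ A
FOL⊆FOL□ (FOLDer.taut _ t)    = FOL□.taut t
FOL⊆FOL□ (FOLDer.inst _ a)    = FOL□.inst a
FOL⊆FOL□ (FOLDer.dist _ _ x∉) = FOL□.dist x∉
FOL⊆FOL□ FOLDer.refl≐         = FOL□.refl≐
FOL⊆FOL□ (FOLDer.ident b a)   = FOL□.ident b a
FOL⊆FOL□ (FOLDer.gen d)       = generalise (FOL⊆FOL□ d)
FOL⊆FOL□ (FOLDer.mp d e)      = FOL⊆FOL□ d · FOL⊆FOL□ e

infix 4 _⇔_
_⇔_ : Formula → Formula → Set
A ⇔ B = FOL□ (A ⇒ B) × FOL□ (B ⇒ A)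

⇔-refl : ∀ A → A ⇔ A
⇔-refl A = ⇒-refl A , ⇒-refl A

¬-cong : ∀ {A B} → A ⇔ B → ¬' A ⇔ ¬' B
¬-cong (⊢A⇒B , ⊢B⇒A) = contrapose ⊢B⇒A , contrapose ⊢A⇒B

⇒-cong : ∀ {A A′ B B′} → A ⇔ A′ → B ⇔ B′ → (A ⇒ B) ⇔ (A′ ⇒ B′)
⇒-cong (⊢A⇒A′ , ⊢A′⇒A) (⊢B⇒B′ , ⊢B′⇒B) = ⇒-mono ⊢A′⇒A ⊢B⇒B′ , ⇒-mono ⊢A⇒A′ ⊢B′⇒B

∀-cong : ∀ {x A B} → A ⇔ B → ∀' x A ⇔ ∀' x B
∀-cong (⊢A⇒B , ⊢B⇒A) = ∀-mono ⊢A⇒B , ∀-mono ⊢B⇒A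

□-cong : ∀ {A B} → A ⇔ B → □ A ⇔ □ B
□-cong (⊢A⇒B , ⊢B⇒A) = □-mono ⊢A⇒B , □-mono ⊢B⇒A

verum : Formula
verum = 0 ≐ 0

provable⇔verum : ∀ {A} → FOL□ A → A ⇔ verum
provable⇔verum ⊢A = ⇒-const FOL□.refl≐ , ⇒-const ⊢A

refutable⇔falsum : ∀ {A} → FOL□ (¬' A) → A ⇔ ¬' verum
refutable⇔falsum ⊢¬A = ⇒-from-refuted ⊢¬A , ¬⇒-from-proved FOL□.refl≐

Decided : Formula → Set
Decided A = FOL□ A ⊎ FOL□ (¬' A)

Decided-resp-⇔ : ∀ {A B} → A ⇔ B → Decided A → Decided B
Decided-resp-⇔ (⊢A⇒B , _) (inj₁ ⊢A)  = inj₁ (⊢A⇒B · ⊢A)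
Decided-resp-⇔ (_ , ⊢B⇒A) (inj₂ ⊢¬A) = inj₂ (contrapose ⊢B⇒A · ⊢¬A)

□-decided-if-box-free : ∀ {A} → BoxFree A → Dec (FOL A) → Decided (□ A)
□-decided-if-box-free _  (yes (_ , ⊢A)) = inj₁ (FOL□.nec (FOL⊆FOL□ ⊢A))
□-decided-if-box-free bf (no ⊬A)        = inj₂ (FOL□.non□ bf ⊬A)

BoxFreeForm : Formula → Set
BoxFreeForm A = Σ Formula λ A′ → BoxFree A′ × A ⇔ A′

box-free-form-if-decided : ∀ {A} → Decided A → BoxFreeForm A
box-free-form-if-decided (inj₁ ⊢A)  = verum , tt , provable⇔verum ⊢A
box-free-form-if-decided (inj₂ ⊢¬A) = ¬' verum , tt , refutable⇔falsum ⊢¬A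

□-decided : ∀ A → DoubleNegation (Decided (□ A))
box-free-form : ∀ A → DoubleNegation (BoxFreeForm A)

□-decided A = do
  A′ , bf , A⇔A′ ← box-free-form A
  FOL-A′? ← ¬¬-excluded-middle
  return (Decided-resp-⇔ (□-cong (swap A⇔A′)) (□-decided-if-box-free bf FOL-A′?))

box-free-form (a ≐ b)     = return (a ≐ b , tt , ⇔-refl _)
box-free-form (pred p as) = return (pred p as , tt , ⇔-refl _)
box-free-form (¬' A) = do
  A′ , bf , A⇔A′ ← box-free-form A
  return (¬' A′ , bf , ¬-cong A⇔A′)
box-free-form (A ⇒ B) = do
  A′ , bfA , A⇔A′ ← box-free-form A
  B′ , bfB , B⇔B′ ← box-free-form B
  return (A′ ⇒ B′ , (bfA , bfB) , ⇒-cong A⇔A′ B⇔B′)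
box-free-form (∀' x A) = do
  A′ , bf , A⇔A′ ← box-free-form A
  return (∀' x A′ , bf , ∀-cong A⇔A′)
box-free-form (□ A) = box-free-form-if-decided <$> □-decided A

insert : Formula → FSet → FSet
insert A Δ B = Δ B ⊎ B ≡ A

ImpliedBy : FSet → Formula → Set
ImpliedBy Δ A = Σ Formula λ C → Σ (List Formula) λ Cs →
                Δ C × All Δ Cs × FOL□ (conj C Cs ⇒ A)

conj-insert-provable : ∀ {Δ A B Bs} → FOL□ A → insert A Δ B → All (insert A Δ) Bs →
                       FOL□ (conj B Bs) ⊎ ImpliedBy Δ (conj B Bs)
conj-insert-provable {B = B} ⊢A (inj₁ B∈Δ) [] = inj₂ (B , [] , B∈Δ , [] , ⇒-refl B)
conj-insert-provable ⊢A (inj₂ refl) []        = inj₁ ⊢A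
conj-insert-provable {B = B} ⊢A B∈ (C∈ ∷ Cs∈) with conj-insert-provable ⊢A C∈ Cs∈ | B∈
... | inj₁ ⊢rest | inj₁ B∈Δ =
  inj₂ (B , [] , B∈Δ , [] , ∧-intro (⇒-refl B) (⇒-const ⊢rest))
... | inj₁ ⊢rest | inj₂ refl =
  inj₁ (∧-intro (⇒-refl B) (⇒-const ⊢rest) · ⊢A)
... | inj₂ (E , Es , E∈Δ , Es∈Δ , ⊢Es⇒rest) | inj₁ B∈Δ =
  inj₂ (B , E ∷ Es , B∈Δ , E∈Δ ∷ Es∈Δ , ∧-monoʳ ⊢Es⇒rest)
... | inj₂ (E , Es , E∈Δ , Es∈Δ , ⊢Es⇒rest) | inj₂ refl =
  inj₂ (E , Es , E∈Δ , Es∈Δ , ∧-intro (⇒-const ⊢A) ⊢Es⇒rest)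

FOL□-Consistent : Set
FOL□-Consistent = ∀ {A} → FOL□ A → ¬ FOL□ (¬' A)

FOL□-consistent-if-member : ∀ {Γ A} → Consistent Γ → Γ A → FOL□-Consistent
FOL□-consistent-if-member {A = A} con A∈Γ ⊢B ⊢¬B = con A [] A∈Γ [] (explode ⊢B ⊢¬B)

insert-provable-consistent : ∀ {Δ A} → FOL□-Consistent → Consistent Δ → FOL□ A →
                             Consistent (insert A Δ)
insert-provable-consistent noContradiction con ⊢A B Bs B∈ Bs∈ ⊢¬conj
  with conj-insert-provable ⊢A B∈ Bs∈
... | inj₁ ⊢conj = noContradiction ⊢conj ⊢¬conj
... | inj₂ (C , Cs , C∈Δ , Cs∈Δ , ⊢Cs⇒conj) = con C Cs C∈Δ Cs∈Δ (contrapose ⊢Cs⇒conj · ⊢¬conj)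

consistent-stable : ∀ {Γ} → Stable (Consistent Γ)
consistent-stable ¬¬con B Bs B∈ Bs∈ ⊢¬conj = ¬¬con λ con → con B Bs B∈ Bs∈ ⊢¬conj

provable∈max-consistent : ∀ {Δ A} → FOL□-Consistent → MaxConsistent Δ →
                          DoubleNegation (FOL□ A) → Δ A
provable∈max-consistent {Δ} {A} noContradiction (con , maximal) ¬¬⊢A =
  maximal (insert A Δ) inj₁
    (consistent-stable (insert-provable-consistent noContradiction con <$> ¬¬⊢A))
    (inj₂ refl)

□-member-provable : ∀ {Γ A} → Consistent Γ → Γ (□ A) → DoubleNegation (FOL□ A)
□-member-provable {A = A} con □A∈Γ = [ FOL□.T ·_ , refuted ] <$> □-decided A
  where
  refuted : FOL□ (¬' □ A) → FOL□ A
  refuted ⊢¬□A = contradiction ⊢¬□A (con (□ A) [] □A∈Γ [])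

theorem2 : (Γ Δ : FSet) → MC Γ → MC Δ → R Γ Δ
theorem2 Γ Δ MCΓ@(_ , conΓ , _) MCΔ@(_ , maxΔ) = MCΓ , MCΔ , □-elim
  where
  □-elim : ∀ A → Γ (□ A) → Δ A
  □-elim A □A∈Γ = provable∈max-consistent (FOL□-consistent-if-member conΓ □A∈Γ) maxΔ
                    (□-member-provable conΓ □A∈Γ)
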